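{- Let $G=(V,E)$ be a regular graph and let $G'=(V',E')$ with $V'=V\times\{ -1,1\}$ and $E'=\{((v,b),(u,b')) : (v,u)\in E,\ b\ne b'\}$. Then: (1) if $G$ has a cut of fractional size $1-\delta$, then $G'$ has a cut of fractional size at least $1-\delta$; (2) if $G$ is an $(\varepsilon,\gamma)$ small-set expander, then $G'$ is an $(\varepsilon/2,\gamma/2)$ small-set expander.
   Context: A cut of fractional size $1-\delta$ is a bipartition of the vertex set cutting a $1-\delta$ fraction of the edges. For $S$ a set of vertices, $\Phi(S)$ is the fraction of edges incident to $S$ (counted as pairs $(v,u)$ with $v\in S$) whose other endpoint lies outside $S$; a regular graph is an $(\varepsilon,\gamma)$ small-set expander if every vertex set $S$ of fractional size at most $\varepsilon$ has $\Phi(S)\ge\gamma$. -}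

module Defs where

open import Data.Nat using (ℕ; zero; suc; _+_) renaming (_*_ to _*ℕ_)
open import Data.Bool using (Bool; true; false; _∧_; not; if_then_else_)
open import Data.Fin using (Fin; zero; suc; remQuot)
open import Data.Fin.Properties using (_≟_)
open import Data.Product using (_×_; _,_; ∃)
open import Data.Integer using (+_)
open import Data.Rational using (ℚ; _/_; _*_; _≤_)
open import Relation.Nullary.Decidable using (⌊_⌋)
open import Relation.Binary.PropositionalEquality using (_≡_; refl)
open import Data.Product using (proj₁; proj₂)

record Graph : Set where
  field
    n     : ℕ
    adj   : Fin n → Fin n → Bool
    sym   : ∀ v u → adj v u ≡ adj u v
    irref : ∀ v → adj v v ≡ false
open Graph public

count : ∀ {m} → (Fin m → Bool) → ℕ
count {zero}  p = 0
count {suc m} p = (if p zero then 1 else 0) + count (λ i → p (suc i))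

sumF : ∀ {m} → (Fin m → ℕ) → ℕ
sumF {zero}  f = 0
sumF {suc m} f = f zero + sumF (λ i → f (suc i))

toℚ : ℕ → ℚ
toℚ k = + k / 1

_≢ᵇ_ : Bool → Bool → Bool
true  ≢ᵇ b = not b
false ≢ᵇ b = b

degree : (G : Graph) → Fin (n G) → ℕ
degree G v = count (adj G v)

Regular : Graph → Set
Regular G = ∃ λ d → ∀ v → degree G v ≡ d

edgePairs : Graph → ℕ
edgePairs G = sumF (degree G)

cutPairs : (G : Graph) → (Fin (n G) → Bool) → ℕ
cutPairs G side = sumF (λ v → count (λ u → adj G v u ∧ (side v ≢ᵇ side u)))

-- "side is a cut of fractional size x":  cutPairs / edgePairs = x
-- (written multiplicatively to avoid division by the edge count)
CutOfSize : (G : Graph) → (Fin (n G) → Bool) → ℚ → Set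
CutOfSize G side x = toℚ (cutPairs G side) ≡ x * toℚ (edgePairs G)

CutOfSizeAtLeast : (G : Graph) → (Fin (n G) → Bool) → ℚ → Set
CutOfSizeAtLeast G side x = x * toℚ (edgePairs G) ≤ toℚ (cutPairs G side)

incidentPairs : (G : Graph) → (Fin (n G) → Bool) → ℕ
incidentPairs G S = sumF (λ v → count (λ u → adj G v u ∧ S v))

leavingPairs : (G : Graph) → (Fin (n G) → Bool) → ℕ
leavingPairs G S = sumF (λ v → count (λ u → adj G v u ∧ (S v ∧ not (S u))))

-- (ε , γ) small-set expander: every S with |S| ≤ ε |V| has Φ(S) ≥ γ,
-- where Φ(S) = leavingPairs / incidentPairs (stated multiplicatively).
SmallSetExpander : Graph → ℚ → ℚ → Set
SmallSetExpander G ε γ =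
  (S : Fin (n G) → Bool) →
  toℚ (count S) ≤ ε * toℚ (n G) →
  γ * toℚ (incidentPairs G S) ≤ toℚ (leavingPairs G S)

-- The bipartite double cover G' of G:  V' = V × {-1,1}, where {-1,1} is
-- encoded as Fin 2, and V × Fin 2 is encoded as Fin (n * 2) via remQuot.
-- (v , b) ~ (u , b')  iff  v ~ u in G and b ≠ b'.
vert : (G : Graph) → Fin (n G *ℕ 2) → Fin (n G)
vert G i = proj₁ (remQuot 2 i)

sgn : (G : Graph) → Fin (n G *ℕ 2) → Fin 2
sgn G i = proj₂ (remQuot {n G} 2 i)

diff2 : Fin 2 → Fin 2 → Bool
diff2 b b' = not ⌊ b ≟ b' ⌋

diff2-sym : ∀ b b' → diff2 b b' ≡ diff2 b' b
diff2-sym zero zero = refl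
diff2-sym zero (suc zero) = refl
diff2-sym (suc zero) zero = refl
diff2-sym (suc zero) (suc zero) = refl

diff2-irr : ∀ b → diff2 b b ≡ false
diff2-irr zero = refl
diff2-irr (suc zero) = refl

doubleCoverAdj : (G : Graph) → Fin (n G *ℕ 2) → Fin (n G *ℕ 2) → Bool
doubleCoverAdj G i j = adj G (vert G i) (vert G j) ∧ diff2 (sgn G i) (sgn G j)

private
  ∧-false : ∀ a → (a ∧ false) ≡ false
  ∧-false true = refl
  ∧-false false = refl

doubleCover : Graph → Graph
doubleCover G = record
  { n     = n G *ℕ 2
  ; adj   = doubleCoverAdj G
  ; sym   = λ i j → symPf i j
  ; irref = λ i → irrPf i
  }
  where
  symPf : ∀ i j → doubleCoverAdj G i j ≡ doubleCoverAdj G j i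
  symPf i j rewrite sym G (vert G i) (vert G j) | diff2-sym (sgn G i) (sgn G j) = refl
  irrPf : ∀ i → doubleCoverAdj G i i ≡ false
  irrPf i rewrite irref G (vert G i) = refl

-- Project a set S' of the double cover to its shadow U = {v | (v,0) ∈ S' or (v,1) ∈ S'}.
-- Since (v,b) has the same degree as v, S' is incident to at most twice as many edges as U,
-- while every edge (v,u) leaving U lifts to an edge ((v,b),(u,1-b)) leaving S', where
-- (v,b) ∈ S' witnesses v ∈ U.  As |U| ≤ |S'|, halving ε and γ absorbs the factor 2.
-- Lifting a bipartition along V × {-1,1} → V doubles both the cut and the edge count.
module Submission where

open import Defs hiding (sym)
open import Data.Nat using (ℕ; zero; suc; z≤n) renaming (_+_ to _+ℕ_; _*_ to _*ℕ_; _≤_ to _≤ℕ_)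
import Data.Nat.Properties as ℕ
open import Data.Bool using (Bool; true; false; _∧_; _∨_; not; if_then_else_; b≤b; f≤t) renaming (_≤_ to _≤ᵇ_)
open import Data.Bool.Properties using (∧-identityʳ; ∧-zeroʳ; ∧-distribˡ-∨; ≤-minimum; ≤-maximum)
open import Data.Fin using (Fin; zero; suc; combine)
open import Data.Fin.Patterns using (0F; 1F)
open import Data.Fin.Properties using (remQuot-combine)
open import Data.Product using (_×_; _,_; ∃; proj₁; proj₂)
open import Data.Sum using (inj₁; inj₂)
open import Data.Integer using (+_; +≤+)
import Data.Integer as ℤ
import Data.Integer.Properties as ℤ
open import Data.Rational using (ℚ; 0ℚ; 1ℚ; ½; _-_; _+_; _*_; _≤_; *≤*; NonNegative; nonNegative)
open import Data.Rational.Literals using (fromℤ)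
import Data.Rational.Properties as ℚ
open import Function using (_∘_)
open import Algebra.Properties.CommutativeSemigroup ℕ.+-commutativeSemigroup using (interchange)
open import Relation.Binary.PropositionalEquality

ind : Bool → ℕ
ind b = if b then 1 else 0

count≡sumF-ind : ∀ {m} (p : Fin m → Bool) → count p ≡ sumF (ind ∘ p)
count≡sumF-ind {zero}  p = refl
count≡sumF-ind {suc m} p = cong (ind (p zero) +ℕ_) (count≡sumF-ind (p ∘ suc))

sumF-cong : ∀ {m} {f g : Fin m → ℕ} → (∀ i → f i ≡ g i) → sumF f ≡ sumF g
sumF-cong {zero}  f≡g = refl
sumF-cong {suc m} f≡g = cong₂ _+ℕ_ (f≡g zero) (sumF-cong (f≡g ∘ suc))

sumF-mono : ∀ {m} {f g : Fin m → ℕ} → (∀ i → f i ≤ℕ g i) → sumF f ≤ℕ sumF g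
sumF-mono {zero}  f≤g = z≤n
sumF-mono {suc m} f≤g = ℕ.+-mono-≤ (f≤g zero) (sumF-mono (f≤g ∘ suc))

sumF-+ : ∀ {m} (f g : Fin m → ℕ) → sumF (λ i → f i +ℕ g i) ≡ sumF f +ℕ sumF g
sumF-+ {zero}  f g = refl
sumF-+ {suc m} f g = begin
  (f zero +ℕ g zero) +ℕ sumF (λ i → f (suc i) +ℕ g (suc i))
    ≡⟨ cong ((f zero +ℕ g zero) +ℕ_) (sumF-+ (f ∘ suc) (g ∘ suc)) ⟩
  (f zero +ℕ g zero) +ℕ (sumF (f ∘ suc) +ℕ sumF (g ∘ suc))
    ≡⟨ interchange (f zero) (g zero) _ _ ⟩
  (f zero +ℕ sumF (f ∘ suc)) +ℕ (g zero +ℕ sumF (g ∘ suc)) ∎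
  where open ≡-Reasoning

sumF-combine : ∀ {m} (f : Fin (m *ℕ 2) → ℕ) →
  sumF f ≡ sumF (λ (v : Fin m) → f (combine v 0F) +ℕ f (combine v 1F))
sumF-combine {zero}  f = refl
sumF-combine {suc m} f =
  trans (sym (ℕ.+-assoc (f 0F) (f 1F) _)) (cong (f 0F +ℕ f 1F +ℕ_) (sumF-combine {m} (λ i → f (suc (suc i)))))

count-false : ∀ {m} → count {m} (λ _ → false) ≡ 0
count-false {zero}  = refl
count-false {suc m} = count-false {m}

count-cong : ∀ {m} {p q : Fin m → Bool} → (∀ i → p i ≡ q i) → count p ≡ count q
count-cong {p = p} {q} p≡q = begin
  count p        ≡⟨ count≡sumF-ind p ⟩
  sumF (ind ∘ p) ≡⟨ sumF-cong (cong ind ∘ p≡q) ⟩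
  sumF (ind ∘ q) ≡⟨ count≡sumF-ind q ⟨
  count q        ∎
  where open ≡-Reasoning

count-mono : ∀ {m} {p q : Fin m → Bool} → (∀ i → p i ≤ᵇ q i) → count p ≤ℕ count q
count-mono {p = p} {q} p≤q = begin
  count p        ≡⟨ count≡sumF-ind p ⟩
  sumF (ind ∘ p) ≤⟨ sumF-mono (ind-mono ∘ p≤q) ⟩
  sumF (ind ∘ q) ≡⟨ count≡sumF-ind q ⟨
  count q        ∎
  where
  open ℕ.≤-Reasoning
  ind-mono : ∀ {a b} → a ≤ᵇ b → ind a ≤ℕ ind b
  ind-mono f≤t = z≤n
  ind-mono b≤b = ℕ.≤-refl

count-∨ : ∀ {m} (p q : Fin m → Bool) → count (λ i → p i ∨ q i) ≤ℕ count p +ℕ count q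
count-∨ p q = begin
  count (λ i → p i ∨ q i)                ≡⟨ count≡sumF-ind (λ i → p i ∨ q i) ⟩
  sumF (λ i → ind (p i ∨ q i))           ≤⟨ sumF-mono (λ i → ind-∨ (p i) (q i)) ⟩
  sumF (λ i → ind (p i) +ℕ ind (q i))    ≡⟨ sumF-+ (ind ∘ p) (ind ∘ q) ⟩
  sumF (ind ∘ p) +ℕ sumF (ind ∘ q)       ≡⟨ cong₂ _+ℕ_ (count≡sumF-ind p) (count≡sumF-ind q) ⟨
  count p +ℕ count q                     ∎
  where
  open ℕ.≤-Reasoning
  ind-∨ : ∀ a b → ind (a ∨ b) ≤ℕ ind a +ℕ ind b
  ind-∨ true  b = ℕ.m≤m+n 1 (ind b)
  ind-∨ false b = ℕ.≤-refl

count-combine : ∀ {m} (p : Fin (m *ℕ 2) → Bool) →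
  count p ≡ count (λ (v : Fin m) → p (combine v 0F)) +ℕ count (λ (v : Fin m) → p (combine v 1F))
count-combine {m} p = begin
  count p
    ≡⟨ count≡sumF-ind p ⟩
  sumF (ind ∘ p)
    ≡⟨ sumF-combine {m} (ind ∘ p) ⟩
  sumF (λ v → ind (p₀ v) +ℕ ind (p₁ v))
    ≡⟨ sumF-+ (ind ∘ p₀) (ind ∘ p₁) ⟩
  sumF (ind ∘ p₀) +ℕ sumF (ind ∘ p₁)
    ≡⟨ cong₂ _+ℕ_ (count≡sumF-ind p₀) (count≡sumF-ind p₁) ⟨
  count p₀ +ℕ count p₁ ∎
  where
  open ≡-Reasoning
  p₀ p₁ : Fin m → Bool
  p₀ v = p (combine v 0F)
  p₁ v = p (combine v 1F)

toℚ≡fromℤ : ∀ k → toℚ k ≡ fromℤ (+ k)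
toℚ≡fromℤ k = ℚ.↥p/↧p≡p (fromℤ (+ k))

toℚ-+ : ∀ a b → toℚ (a +ℕ b) ≡ toℚ a + toℚ b
toℚ-+ a b rewrite toℚ≡fromℤ a | toℚ≡fromℤ b =
  ℚ./-cong {+ (a +ℕ b)} {1} (sym (cong₂ ℤ._+_ (ℤ.*-identityʳ (+ a)) (ℤ.*-identityʳ (+ b)))) refl

toℚ-mono : ∀ {a b} → a ≤ℕ b → toℚ a ≤ toℚ b
toℚ-mono {a} {b} a≤b rewrite toℚ≡fromℤ a | toℚ≡fromℤ b =
  *≤* (subst₂ ℤ._≤_ (sym (ℤ.*-identityʳ (+ a))) (sym (ℤ.*-identityʳ (+ b))) (+≤+ a≤b))

*½-double : ∀ a k → (a * ½) * toℚ (k +ℕ k) ≡ a * toℚ k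
*½-double a k = begin
  (a * ½) * toℚ (k +ℕ k)       ≡⟨ cong ((a * ½) *_) (toℚ-+ k k) ⟩
  (a * ½) * (toℚ k + toℚ k)    ≡⟨ ℚ.*-assoc a ½ _ ⟩
  a * (½ * (toℚ k + toℚ k))    ≡⟨ cong (a *_) (ℚ.*-distribˡ-+ ½ (toℚ k) (toℚ k)) ⟩
  a * (½ * toℚ k + ½ * toℚ k)  ≡⟨ cong (a *_) (ℚ.*-distribʳ-+ (toℚ k) ½ ½) ⟨
  a * ((½ + ½) * toℚ k)        ≡⟨ cong (a *_) (ℚ.*-identityˡ (toℚ k)) ⟩
  a * toℚ k                    ∎
  where open ≡-Reasoning

-- For γ < 0 the conclusion holds because its left side is ≤ 0.
*½-transfer : ∀ γ {i i′ l l′} → i′ ≤ℕ i +ℕ i → l ≤ℕ l′ →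
  γ * toℚ i ≤ toℚ l → (γ * ½) * toℚ i′ ≤ toℚ l′
*½-transfer γ {i} {i′} {l} {l′} i′≤2i l≤l′ γi≤l with ℚ.≤-total 0ℚ γ
... | inj₁ 0≤γ = begin
  (γ * ½) * toℚ i′      ≤⟨ ℚ.*-monoˡ-≤-nonNeg (γ * ½) {{γ½≥0}} (toℚ-mono i′≤2i) ⟩
  (γ * ½) * toℚ (i +ℕ i) ≡⟨ *½-double γ i ⟩
  γ * toℚ i             ≤⟨ γi≤l ⟩
  toℚ l                 ≤⟨ toℚ-mono l≤l′ ⟩
  toℚ l′                ∎
  where
  open ℚ.≤-Reasoning
  γ½≥0 : NonNegative (γ * ½)
  γ½≥0 = nonNegative (ℚ.*-monoʳ-≤-nonNeg ½ 0≤γ)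
... | inj₂ γ≤0 = begin
  (γ * ½) * toℚ i′  ≤⟨ ℚ.*-monoʳ-≤-nonNeg (toℚ i′) {{nonNegative (toℚ-mono {0} {i′} z≤n)}} (ℚ.*-monoʳ-≤-nonNeg ½ γ≤0) ⟩
  0ℚ * toℚ i′       ≡⟨ ℚ.*-zeroˡ (toℚ i′) ⟩
  toℚ 0             ≤⟨ toℚ-mono {0} {l′} z≤n ⟩
  toℚ l′            ∎
  where open ℚ.≤-Reasoning

≤ᵇ-∨ˡ : ∀ a b → a ≤ᵇ a ∨ b
≤ᵇ-∨ˡ true  b = b≤b
≤ᵇ-∨ˡ false b = ≤-minimum b

≤ᵇ-∨ʳ : ∀ a b → b ≤ᵇ a ∨ b
≤ᵇ-∨ʳ true  b = ≤-maximum b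
≤ᵇ-∨ʳ false b = b≤b

∧-monoʳ-≤ᵇ : ∀ a {b c} → b ≤ᵇ c → a ∧ b ≤ᵇ a ∧ c
∧-monoʳ-≤ᵇ true  b≤c = b≤c
∧-monoʳ-≤ᵇ false b≤c = b≤b

-- With a, b, c, d the memberships of (v,0), (v,1), (u,0), (u,1): an edge leaving the shadow
-- lifts to ((v,0),(u,1)) or ((v,1),(u,0)) leaving S.
∨-leaving : ∀ a b c d → (a ∨ b) ∧ not (c ∨ d) ≤ᵇ (a ∧ not d) ∨ (b ∧ not c)
∨-leaving true  _     true  _     = ≤-minimum _
∨-leaving true  _     false true  = ≤-minimum _
∨-leaving true  _     false false = b≤b
∨-leaving false false _     _     = b≤b
∨-leaving false true  true  _     = b≤b
∨-leaving false true  false true  = f≤t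
∨-leaving false true  false false = b≤b

flip : Fin 2 → Fin 2
flip 0F = 1F
flip 1F = 0F

-- cutPairs, incidentPairs and leavingPairs are all definitionally instances of pairCount.
pairCount : (G : Graph) → (Fin (n G) → Fin (n G) → Bool) → ℕ
pairCount G P = sumF (λ v → count (λ u → adj G v u ∧ P v u))

module _ (G : Graph) where

  pairCount-cong : ∀ {P Q} → (∀ v u → P v u ≡ Q v u) → pairCount G P ≡ pairCount G Q
  pairCount-cong P≡Q = sumF-cong λ v → count-cong λ u → cong (adj G v u ∧_) (P≡Q v u)

  pairCount-mono : ∀ {P Q} → (∀ v u → P v u ≤ᵇ Q v u) → pairCount G P ≤ℕ pairCount G Q
  pairCount-mono P≤Q = sumF-mono λ v → count-mono λ u → ∧-monoʳ-≤ᵇ (adj G v u) (P≤Q v u)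

  pairCount-∨ : ∀ P Q → pairCount G (λ v u → P v u ∨ Q v u) ≤ℕ pairCount G P +ℕ pairCount G Q
  pairCount-∨ P Q = ℕ.≤-trans
    (sumF-mono λ v → ℕ.≤-trans
      (ℕ.≤-reflexive (count-cong λ u → ∧-distribˡ-∨ (adj G v u) (P v u) (Q v u)))
      (count-∨ (λ u → adj G v u ∧ P v u) (λ u → adj G v u ∧ Q v u)))
    (ℕ.≤-reflexive (sumF-+ {n G} _ _))

  edgePairs≡pairCount : edgePairs G ≡ pairCount G (λ _ _ → true)
  edgePairs≡pairCount = sumF-cong λ v → count-cong λ u → sym (∧-identityʳ (adj G v u))

module _ (G : Graph) where

  private
    V V' : Set
    V  = Fin (n G)
    V' = Fin (n G *ℕ 2)

  vert-combine : ∀ (v : V) b → vert G (combine v b) ≡ v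
  vert-combine v b = cong proj₁ (remQuot-combine v b)

  sgn-combine : ∀ (v : V) b → sgn G (combine v b) ≡ b
  sgn-combine v b = cong proj₂ (remQuot-combine v b)

  doubleCoverAdj-combine : ∀ (v : V) b u b' →
    doubleCoverAdj G (combine v b) (combine u b') ≡ adj G v u ∧ diff2 b b'
  doubleCoverAdj-combine v b u b' =
    cong₂ _∧_ (cong₂ (adj G) (vert-combine v b) (vert-combine u b'))
              (cong₂ diff2 (sgn-combine v b) (sgn-combine u b'))

  doubleCover-neighbours : ∀ v b (Y : V' → Bool) →
    count (λ j → doubleCoverAdj G (combine v b) j ∧ Y j)
      ≡ count (λ u → adj G v u ∧ Y (combine u (flip b)))
  doubleCover-neighbours v b Y = begin
    count (λ j → doubleCoverAdj G (combine v b) j ∧ Y j)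
      ≡⟨ count-combine {n G} _ ⟩
    count (λ (u : V) → doubleCoverAdj G (combine v b) (combine u 0F) ∧ Y (combine u 0F))
      +ℕ count (λ (u : V) → doubleCoverAdj G (combine v b) (combine u 1F) ∧ Y (combine u 1F))
      ≡⟨ cong₂ _+ℕ_ (count-cong (lift 0F)) (count-cong (lift 1F)) ⟩
    count (λ (u : V) → (adj G v u ∧ diff2 b 0F) ∧ Y (combine u 0F))
      +ℕ count (λ (u : V) → (adj G v u ∧ diff2 b 1F) ∧ Y (combine u 1F))
      ≡⟨ select b ⟩
    count (λ (u : V) → adj G v u ∧ Y (combine u (flip b))) ∎
    where
    open ≡-Reasoning
    lift : ∀ b' u → doubleCoverAdj G (combine v b) (combine u b') ∧ Y (combine u b')
                      ≡ (adj G v u ∧ diff2 b b') ∧ Y (combine u b')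
    lift b' u = cong (_∧ Y (combine u b')) (doubleCoverAdj-combine v b u b')
    killed : ∀ b' → count (λ u → (adj G v u ∧ false) ∧ Y (combine u b')) ≡ 0
    killed b' = trans (count-cong λ u → cong (_∧ Y (combine u b')) (∧-zeroʳ (adj G v u))) (count-false {n G})
    kept : ∀ b' → count (λ u → (adj G v u ∧ true) ∧ Y (combine u b')) ≡ count (λ u → adj G v u ∧ Y (combine u b'))
    kept b' = count-cong λ u → cong (_∧ Y (combine u b')) (∧-identityʳ (adj G v u))
    select : ∀ b → count (λ u → (adj G v u ∧ diff2 b 0F) ∧ Y (combine u 0F))
                     +ℕ count (λ u → (adj G v u ∧ diff2 b 1F) ∧ Y (combine u 1F))
                     ≡ count (λ u → adj G v u ∧ Y (combine u (flip b)))
    select 0F = cong₂ _+ℕ_ (killed 0F) (kept 1F)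
    select 1F = trans (cong₂ _+ℕ_ (kept 0F) (killed 1F)) (ℕ.+-identityʳ _)

  pairCount-doubleCover : ∀ (P : V' → V' → Bool) →
    pairCount (doubleCover G) P
      ≡ pairCount G (λ v u → P (combine v 0F) (combine u 1F))
        +ℕ pairCount G (λ v u → P (combine v 1F) (combine u 0F))
  pairCount-doubleCover P =
    trans (sumF-combine {n G} _)
      (trans (sumF-cong λ v → cong₂ _+ℕ_ (doubleCover-neighbours v 0F (P (combine v 0F)))
                                         (doubleCover-neighbours v 1F (P (combine v 1F))))
             (sumF-+ {n G} _ _))

  edgePairs-doubleCover : edgePairs (doubleCover G) ≡ edgePairs G +ℕ edgePairs G
  edgePairs-doubleCover = begin
    edgePairs (doubleCover G)                                ≡⟨ edgePairs≡pairCount (doubleCover G) ⟩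
    pairCount (doubleCover G) (λ _ _ → true)                 ≡⟨ pairCount-doubleCover _ ⟩
    pairCount G (λ _ _ → true) +ℕ pairCount G (λ _ _ → true) ≡⟨ cong₂ _+ℕ_ (edgePairs≡pairCount G) (edgePairs≡pairCount G) ⟨
    edgePairs G +ℕ edgePairs G                               ∎
    where open ≡-Reasoning

  cutPairs-doubleCover : ∀ side → cutPairs (doubleCover G) (side ∘ vert G) ≡ cutPairs G side +ℕ cutPairs G side
  cutPairs-doubleCover side =
    trans (pairCount-doubleCover _) (cong₂ _+ℕ_ (pairCount-cong G (lifted 0F 1F)) (pairCount-cong G (lifted 1F 0F)))
    where
    lifted : ∀ b b' v u → (side (vert G (combine v b)) ≢ᵇ side (vert G (combine u b'))) ≡ (side v ≢ᵇ side u)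
    lifted b b' v u = cong₂ (λ x y → side x ≢ᵇ side y) (vert-combine v b) (vert-combine u b')

  shadow : (V' → Bool) → V → Bool
  shadow S v = S (combine v 0F) ∨ S (combine v 1F)

  count-shadow : ∀ S → count (shadow S) ≤ℕ count S
  count-shadow S = ℕ.≤-trans (count-∨ {n G} _ _) (ℕ.≤-reflexive (sym (count-combine {n G} S)))

  incidentPairs-doubleCover : ∀ S →
    incidentPairs (doubleCover G) S ≤ℕ incidentPairs G (shadow S) +ℕ incidentPairs G (shadow S)
  incidentPairs-doubleCover S = ℕ.≤-trans (ℕ.≤-reflexive (pairCount-doubleCover _))
    (ℕ.+-mono-≤ (pairCount-mono G λ v _ → ≤ᵇ-∨ˡ (S (combine v 0F)) _)
                (pairCount-mono G λ v _ → ≤ᵇ-∨ʳ _ (S (combine v 1F))))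

  leavingPairs-shadow : ∀ S → leavingPairs G (shadow S) ≤ℕ leavingPairs (doubleCover G) S
  leavingPairs-shadow S = begin
    leavingPairs G (shadow S)
      ≤⟨ pairCount-mono G (λ v u → ∨-leaving (S (combine v 0F)) (S (combine v 1F)) (S (combine u 0F)) (S (combine u 1F))) ⟩
    pairCount G (λ v u → (S (combine v 0F) ∧ not (S (combine u 1F))) ∨ (S (combine v 1F) ∧ not (S (combine u 0F))))
      ≤⟨ pairCount-∨ G _ _ ⟩
    pairCount G (λ v u → S (combine v 0F) ∧ not (S (combine u 1F)))
      +ℕ pairCount G (λ v u → S (combine v 1F) ∧ not (S (combine u 0F)))
      ≡⟨ pairCount-doubleCover _ ⟨
    leavingPairs (doubleCover G) S ∎
    where open ℕ.≤-Reasoning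

  doubleCover-cutOfSize : ∀ side x → CutOfSize G side x → CutOfSize (doubleCover G) (side ∘ vert G) x
  doubleCover-cutOfSize side x cut = begin
    toℚ (cutPairs (doubleCover G) (side ∘ vert G)) ≡⟨ cong toℚ (cutPairs-doubleCover side) ⟩
    toℚ (c +ℕ c)                                   ≡⟨ toℚ-+ c c ⟩
    toℚ c + toℚ c                                  ≡⟨ cong₂ _+_ cut cut ⟩
    x * toℚ e + x * toℚ e                          ≡⟨ ℚ.*-distribˡ-+ x (toℚ e) (toℚ e) ⟨
    x * (toℚ e + toℚ e)                            ≡⟨ cong (x *_) (toℚ-+ e e) ⟨
    x * toℚ (e +ℕ e)                               ≡⟨ cong (λ k → x * toℚ k) edgePairs-doubleCover ⟨
    x * toℚ (edgePairs (doubleCover G))            ∎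
    where
    open ≡-Reasoning
    c e : ℕ
    c = cutPairs G side
    e = edgePairs G

  doubleCover-smallSetExpander : ∀ ε γ → SmallSetExpander G ε γ →
    SmallSetExpander (doubleCover G) (ε * ½) (γ * ½)
  doubleCover-smallSetExpander ε γ expander S small =
    *½-transfer γ {i = incidentPairs G (shadow S)}
      (incidentPairs-doubleCover S) (leavingPairs-shadow S) (expander (shadow S) shadow-small)
    where
    shadow-small : toℚ (count (shadow S)) ≤ ε * toℚ (n G)
    shadow-small = begin
      toℚ (count (shadow S))        ≤⟨ toℚ-mono (count-shadow S) ⟩
      toℚ (count S)                 ≤⟨ small ⟩
      (ε * ½) * toℚ (n G *ℕ 2)      ≡⟨ cong (λ k → (ε * ½) * toℚ k) (ℕ.*-comm (n G) 2) ⟩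
      (ε * ½) * toℚ (2 *ℕ n G)      ≡⟨ cong (λ k → (ε * ½) * toℚ (n G +ℕ k)) (ℕ.+-identityʳ (n G)) ⟩
      (ε * ½) * toℚ (n G +ℕ n G)    ≡⟨ *½-double ε (n G) ⟩
      ε * toℚ (n G)                 ∎
      where open ℚ.≤-Reasoning

claim2p1 : (G : Graph) → Regular G →
    ((δ : ℚ) → (∃ λ (side : Fin (n G) → Bool) → CutOfSize G side (1ℚ - δ)) →
    ∃ λ (side' : Fin (n (doubleCover G)) → Bool) →
    CutOfSizeAtLeast (doubleCover G) side' (1ℚ - δ))
    × ((ε γ : ℚ) → SmallSetExpander G ε γ →
    SmallSetExpander (doubleCover G) (ε * ½) (γ * ½))
claim2p1 G _ = lift-cut , doubleCover-smallSetExpander G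
  where
  lift-cut : ∀ δ → ∃ (λ side → CutOfSize G side (1ℚ - δ)) →
    ∃ λ side' → CutOfSizeAtLeast (doubleCover G) side' (1ℚ - δ)
  lift-cut δ (side , cut) =
    side ∘ vert G , ℚ.≤-reflexive (sym (doubleCover-cutOfSize G side (1ℚ - δ) cut))
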